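{- Let $\mathbf u\in\mathbb{R}^p$, $\mathbf v\in\mathbb{R}^q$ be finite real sequences with concatenation $(\mathbf u,\mathbf v)$, and let $k\in\mathbb{Z}_+$. Then $$S(M^k(\mathbf u,\mathbf v))=S(M^k(\mathbf u))+S(M^k(\mathbf v))+\sum_{\ell=1}^k S(M^{k-\ell}(\mathbf u))S(M^{\ell-1}(\mathbf e_q))=S(M^k(\mathbf u))+S(M^k(\mathbf v))+\sum_{\ell=1}^k S(M^{k-\ell}(\mathbf u))\binom{q+\ell-1}{\ell}.$$
   Context: $\mathbf e_q=(1,\dots,1)\in\mathbb{R}^q$. For a finite sequence $\mathbf a=(a_1,\dots,a_m)$, $S(\mathbf a)=\sum_i a_i$ and $M(\mathbf a)=(a_1,a_1+a_2,\dots,a_1+\dots+a_m)$; $M^0$ is the identity and $M^k=M\circ M^{k-1}$. -}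

module Defs where

open import Level using (Level)
open import Algebra.Bundles using (CommutativeRing)
open import Data.Nat using (ℕ; zero; suc; _∸_)
open import Data.Vec using (Vec; []; _∷_; map; replicate)

-- Everything is parametrised by a commutative ring R (the paper: R = ℝ).
module Seq {c ℓ : Level} (R : CommutativeRing c ℓ) where
  open CommutativeRing R

  S : ∀ {m} → Vec Carrier m → Carrier
  S []       = 0#
  S (a ∷ as) = a + S as

  M : ∀ {m} → Vec Carrier m → Vec Carrier m
  M []       = []
  M (a ∷ as) = a ∷ map (a +_) (M as)

  M^ : ℕ → ∀ {m} → Vec Carrier m → Vec Carrier m
  M^ zero    a = a
  M^ (suc k) a = M (M^ k a)

  e : (q : ℕ) → Vec Carrier q
  e q = replicate q 1#

  ι : ℕ → Carrier
  ι zero    = 0#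
  ι (suc n) = 1# + ι n

  Σ₁ : ℕ → (ℕ → Carrier) → Carrier
  Σ₁ zero    f = 0#
  Σ₁ (suc k) f = Σ₁ k f + f (suc k)

module Submission where

-- Write ⊕ for pointwise sum, s · a for scaling, and shift s a = (s + a₁, …, s + aₘ).
-- The prefix-sum operator M is linear, and on a concatenation it acts as
--   M (u ++ v) = M u ++ shift (S u) (M v) = M u ++ (M v ⊕ S u · e_q).
-- Applying Mᵏ to the right-hand side and using linearity of M and S gives the
-- first identity by induction on k, simultaneously for all u and v: one factor
-- M is peeled off, the induction hypothesis is applied to the pair
-- (M u, M v ⊕ S u · e_q), and the new summand S u · S(Mᵏ e_q) is the term ℓ = k+1.
--
-- For the second identity put T(q, j) = S(Mʲ e_q). Since e_{q+1} = (1) ++ e_q and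
-- Mʲ(1) = (1), the first identity yields T(q+1, j) = 1 + T(q, j) + Σ_{ℓ=1}^{j} T(q, ℓ-1),
-- which is exactly the recursion satisfied by C(q+j, j+1) (a hockey-stick identity,
-- proved over ℕ by Pascal's rule). Hence T(q, ℓ-1) = C(q+ℓ-1, ℓ) in R.

open import Defs
open import Level using (Level)
open import Algebra.Bundles using (CommutativeRing)
import Data.Nat as ℕ
open import Data.Nat using (ℕ)
open import Data.Nat.Combinatorics using (_C_)
open import Data.Vec using (Vec; _++_)
open import Data.Product using (_×_)

open import Data.Product using (_,_)
open import Data.Vec using ([]; _∷_; map; zipWith)
import Data.Nat.Properties as ℕₚ
open import Data.Nat.Combinatorics using (nC1≡n; k>n⇒nCk≡0; nCk+nC[k+1]≡[n+1]C[k+1])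
open import Data.Nat.Solver using (module +-*-Solver)
open import Relation.Binary.PropositionalEquality as ≡ using (_≡_)

ΣN : ℕ → (ℕ → ℕ) → ℕ
ΣN ℕ.zero    f = 0
ΣN (ℕ.suc j) f = ΣN j f ℕ.+ f (ℕ.suc j)

-- For l ≥ 1 this is C(q+l-1, l), written as it arises from T(q, l-1).
binomialTerm : ℕ → ℕ → ℕ
binomialTerm q l = (q ℕ.+ (l ℕ.∸ 1)) C ℕ.suc (l ℕ.∸ 1)

hockeyStick : ∀ q j →
  (ℕ.suc q ℕ.+ j) C ℕ.suc j ≡ 1 ℕ.+ (q ℕ.+ j) C ℕ.suc j ℕ.+ ΣN j (binomialTerm q)
hockeyStick q ℕ.zero = begin
  (ℕ.suc q ℕ.+ 0) C 1       ≡⟨ nC1≡n (ℕ.suc q ℕ.+ 0) ⟩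
  ℕ.suc (q ℕ.+ 0)           ≡⟨ ≡.cong ℕ.suc (nC1≡n (q ℕ.+ 0)) ⟨
  1 ℕ.+ (q ℕ.+ 0) C 1       ≡⟨ ℕₚ.+-identityʳ _ ⟨
  1 ℕ.+ (q ℕ.+ 0) C 1 ℕ.+ 0 ∎
  where open ≡.≡-Reasoning
hockeyStick q (ℕ.suc j) = begin
  (ℕ.suc q ℕ.+ ℕ.suc j) C ℕ.suc (ℕ.suc j)
    ≡⟨ ≡.cong (_C ℕ.suc (ℕ.suc j)) (ℕₚ.+-suc (ℕ.suc q) j) ⟩
  ℕ.suc (ℕ.suc q ℕ.+ j) C ℕ.suc (ℕ.suc j)
    ≡⟨ nCk+nC[k+1]≡[n+1]C[k+1] (ℕ.suc q ℕ.+ j) (ℕ.suc j) ⟨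
  (ℕ.suc q ℕ.+ j) C ℕ.suc j ℕ.+ (ℕ.suc q ℕ.+ j) C ℕ.suc (ℕ.suc j)
    ≡⟨ ≡.cong₂ ℕ._+_ (hockeyStick q j) (≡.cong (_C ℕ.suc (ℕ.suc j)) (≡.sym (ℕₚ.+-suc q j))) ⟩
  1 ℕ.+ a ℕ.+ σ ℕ.+ b
    ≡⟨ regroup a σ b ⟩
  1 ℕ.+ b ℕ.+ (σ ℕ.+ a) ∎
  where
  open ≡.≡-Reasoning
  open +-*-Solver
  a b σ : ℕ
  a = (q ℕ.+ j) C ℕ.suc j
  b = (q ℕ.+ ℕ.suc j) C ℕ.suc (ℕ.suc j)
  σ = ΣN j (binomialTerm q)
  regroup : ∀ a σ b → 1 ℕ.+ a ℕ.+ σ ℕ.+ b ≡ 1 ℕ.+ b ℕ.+ (σ ℕ.+ a)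
  regroup = solve 3 (λ a σ b → con 1 :+ a :+ σ :+ b := con 1 :+ b :+ (σ :+ a)) ≡.refl

module Development {c ℓ} (R : CommutativeRing c ℓ) where
  open CommutativeRing R
  open Seq R
  open import Algebra.Properties.CommutativeSemigroup +-commutativeSemigroup using (interchange)
  open import Data.Vec.Relation.Binary.Equality.Setoid setoid
    using (_≋_; []; _∷_; ≋-refl; ≋-sym; ≋-trans; ++⁺; map⁺; map-++)
  open import Relation.Binary.Reasoning.Setoid setoid

  infixl 6 _⊕_
  infixr 7 _·_

  _⊕_ : ∀ {m} → Vec Carrier m → Vec Carrier m → Vec Carrier m
  _⊕_ = zipWith _+_

  _·_ : ∀ {m} → Carrier → Vec Carrier m → Vec Carrier m
  s · a = map (s *_) a

  shift : ∀ {m} → Carrier → Vec Carrier m → Vec Carrier m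
  shift s = map (s +_)

  S-cong : ∀ {m} {a b : Vec Carrier m} → a ≋ b → S a ≈ S b
  S-cong []         = refl
  S-cong (x≈y ∷ p) = +-cong x≈y (S-cong p)

  S-++ : ∀ {m n} (a : Vec Carrier m) (b : Vec Carrier n) → S (a ++ b) ≈ S a + S b
  S-++ []      b = sym (+-identityˡ (S b))
  S-++ (x ∷ a) b = trans (+-congˡ (S-++ a b)) (sym (+-assoc x (S a) (S b)))

  S-⊕ : ∀ {m} (a b : Vec Carrier m) → S (a ⊕ b) ≈ S a + S b
  S-⊕ []      []      = sym (+-identityˡ 0#)
  S-⊕ (x ∷ a) (y ∷ b) = trans (+-congˡ (S-⊕ a b)) (interchange x y (S a) (S b))

  S-· : ∀ {m} s (a : Vec Carrier m) → S (s · a) ≈ s * S a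
  S-· s []      = sym (zeroʳ s)
  S-· s (x ∷ a) = trans (+-congˡ (S-· s a)) (sym (distribˡ s x (S a)))

  shift-cong : ∀ {m s t} {a b : Vec Carrier m} → s ≈ t → a ≋ b → shift s a ≋ shift t b
  shift-cong s≈t = map⁺ (+-cong s≈t)

  shift-zero : ∀ {m} (a : Vec Carrier m) → shift 0# a ≋ a
  shift-zero []      = []
  shift-zero (x ∷ a) = +-identityˡ x ∷ shift-zero a

  shift-shift : ∀ {m} s t (a : Vec Carrier m) → shift s (shift t a) ≋ shift (s + t) a
  shift-shift s t []      = []
  shift-shift s t (x ∷ a) = sym (+-assoc s t x) ∷ shift-shift s t a

  shift-⊕ : ∀ {m} s t (a b : Vec Carrier m) → shift (s + t) (a ⊕ b) ≋ shift s a ⊕ shift t b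
  shift-⊕ s t []      []      = []
  shift-⊕ s t (x ∷ a) (y ∷ b) = interchange s t x y ∷ shift-⊕ s t a b

  shift-· : ∀ {m} s t (a : Vec Carrier m) → shift (s * t) (s · a) ≋ s · shift t a
  shift-· s t []      = []
  shift-· s t (x ∷ a) = sym (distribˡ s t x) ∷ shift-· s t a

  shift≋⊕e : ∀ {m} s (a : Vec Carrier m) → shift s a ≋ a ⊕ s · e m
  shift≋⊕e s []      = []
  shift≋⊕e s (x ∷ a) = trans (+-comm s x) (+-congˡ (sym (*-identityʳ s))) ∷ shift≋⊕e s a

  M-cong : ∀ {m} {a b : Vec Carrier m} → a ≋ b → M a ≋ M b
  M-cong []         = []
  M-cong (x≈y ∷ p) = x≈y ∷ shift-cong x≈y (M-cong p)

  M^-cong : ∀ k {m} {a b : Vec Carrier m} → a ≋ b → M^ k a ≋ M^ k b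
  M^-cong ℕ.zero    p = p
  M^-cong (ℕ.suc k) p = M-cong (M^-cong k p)

  M-⊕ : ∀ {m} (a b : Vec Carrier m) → M (a ⊕ b) ≋ M a ⊕ M b
  M-⊕ []      []      = []
  M-⊕ (x ∷ a) (y ∷ b) = refl ∷ ≋-trans (shift-cong refl (M-⊕ a b)) (shift-⊕ x y (M a) (M b))

  M-· : ∀ {m} s (a : Vec Carrier m) → M (s · a) ≋ s · M a
  M-· s []      = []
  M-· s (x ∷ a) = refl ∷ ≋-trans (shift-cong refl (M-· s a)) (shift-· s x (M a))

  M^-⊕ : ∀ k {m} (a b : Vec Carrier m) → M^ k (a ⊕ b) ≋ M^ k a ⊕ M^ k b
  M^-⊕ ℕ.zero    a b = ≋-refl
  M^-⊕ (ℕ.suc k) a b = ≋-trans (M-cong (M^-⊕ k a b)) (M-⊕ (M^ k a) (M^ k b))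

  M^-· : ∀ k {m} s (a : Vec Carrier m) → M^ k (s · a) ≋ s · M^ k a
  M^-· ℕ.zero    s a = ≋-refl
  M^-· (ℕ.suc k) s a = ≋-trans (M-cong (M^-· k s a)) (M-· s (M^ k a))

  M^-M : ∀ k {m} (a : Vec Carrier m) → M^ k (M a) ≡ M^ (ℕ.suc k) a
  M^-M ℕ.zero    a = ≡.refl
  M^-M (ℕ.suc k) a = ≡.cong M (M^-M k a)

  M^-M-∸ : ∀ {k l m} (a : Vec Carrier m) → ℕ.suc l ℕ.≤ k → M^ (k ℕ.∸ ℕ.suc l) (M a) ≡ M^ (k ℕ.∸ l) a
  M^-M-∸ {k} {l} a l<k =
    ≡.trans (M^-M (k ℕ.∸ ℕ.suc l) a) (≡.cong (λ n → M^ n a) (≡.sym (ℕₚ.+-∸-assoc 1 l<k)))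

  M-++ : ∀ {m n} (u : Vec Carrier m) (v : Vec Carrier n) → M (u ++ v) ≋ M u ++ shift (S u) (M v)
  M-++ []      v = ≋-sym (shift-zero (M v))
  M-++ (x ∷ u) v = refl ∷ ≋-trans (shift-cong refl (M-++ u v))
    (≋-trans (map-++ (x +_) (M u)) (++⁺ ≋-refl (shift-shift x (S u) (M v))))

  -- The shape of M (u ++ v) used in the induction: M u ++ (M v ⊕ S u · e_q).
  M-++-linear : ∀ {p q} (u : Vec Carrier p) (v : Vec Carrier q) → M (u ++ v) ≋ M u ++ (M v ⊕ S u · e q)
  M-++-linear u v = ≋-trans (M-++ u v) (++⁺ ≋-refl (shift≋⊕e (S u) (M v)))

  S-M^-second : ∀ k {q} s (v : Vec Carrier q) → S (M^ k (M v ⊕ s · e q)) ≈ S (M^ (ℕ.suc k) v) + s * S (M^ k (e q))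
  S-M^-second k {q} s v = begin
    S (M^ k (M v ⊕ s · e q))             ≈⟨ S-cong (M^-⊕ k (M v) (s · e q)) ⟩
    S (M^ k (M v) ⊕ M^ k (s · e q))       ≈⟨ S-⊕ (M^ k (M v)) (M^ k (s · e q)) ⟩
    S (M^ k (M v)) + S (M^ k (s · e q))   ≈⟨ +-cong (reflexive (≡.cong S (M^-M k v))) (S-cong (M^-· k s (e q))) ⟩
    S (M^ (ℕ.suc k) v) + S (s · M^ k (e q)) ≈⟨ +-congˡ (S-· s (M^ k (e q))) ⟩
    S (M^ (ℕ.suc k) v) + s * S (M^ k (e q)) ∎

  Σ₁-cong : ∀ k {f g : ℕ → Carrier} → (∀ l → ℕ.suc l ℕ.≤ k → f (ℕ.suc l) ≈ g (ℕ.suc l)) → Σ₁ k f ≈ Σ₁ k g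
  Σ₁-cong ℕ.zero    f≈g = refl
  Σ₁-cong (ℕ.suc k) f≈g = +-cong (Σ₁-cong k (λ l l<k → f≈g l (ℕₚ.m≤n⇒m≤1+n l<k))) (f≈g k ℕₚ.≤-refl)

  regroup : ∀ a b c d → a + (b + c) + d ≈ a + b + (d + c)
  regroup a b c d = begin
    a + (b + c) + d   ≈⟨ +-congʳ (+-assoc a b c) ⟨
    a + b + c + d     ≈⟨ +-assoc (a + b) c d ⟩
    a + b + (c + d)   ≈⟨ +-congˡ (+-comm c d) ⟩
    a + b + (d + c)   ∎

  sumFormula : ∀ k {p q} (u : Vec Carrier p) (v : Vec Carrier q) →
    S (M^ k (u ++ v)) ≈ S (M^ k u) + S (M^ k v) + Σ₁ k (λ l → S (M^ (k ℕ.∸ l) u) * S (M^ (l ℕ.∸ 1) (e q)))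
  sumFormula ℕ.zero    u v = trans (S-++ u v) (sym (+-identityʳ _))
  sumFormula (ℕ.suc k) {q = q} u v = begin
    S (M (M^ k (u ++ v)))                              ≡⟨ ≡.cong S (M^-M k (u ++ v)) ⟨
    S (M^ k (M (u ++ v)))                              ≈⟨ S-cong (M^-cong k (M-++-linear u v)) ⟩
    S (M^ k (M u ++ (M v ⊕ S u · e q)))                ≈⟨ sumFormula k (M u) (M v ⊕ S u · e q) ⟩
    S (M^ k (M u)) + S (M^ k (M v ⊕ S u · e q)) + Σ₁ k (λ l → S (M^ (k ℕ.∸ l) (M u)) * E l)
      ≈⟨ +-cong (+-cong (reflexive (≡.cong S (M^-M k u))) (S-M^-second k (S u) v))
                (Σ₁-cong k (λ l l<k → *-congʳ (reflexive (≡.cong S (M^-M-∸ u l<k))))) ⟩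
    S (M^ (ℕ.suc k) u) + (S (M^ (ℕ.suc k) v) + S u * E (ℕ.suc k)) + Σ₁ k summand
      ≈⟨ regroup _ _ _ _ ⟩
    S (M^ (ℕ.suc k) u) + S (M^ (ℕ.suc k) v) + (Σ₁ k summand + S u * E (ℕ.suc k))
      ≡⟨ ≡.cong (λ n → S (M^ (ℕ.suc k) u) + S (M^ (ℕ.suc k) v) + (Σ₁ k summand + S (M^ n u) * E (ℕ.suc k)))
                (≡.sym (ℕₚ.n∸n≡0 k)) ⟩
    S (M^ (ℕ.suc k) u) + S (M^ (ℕ.suc k) v) + Σ₁ (ℕ.suc k) summand ∎
    where
    E : ℕ → Carrier
    E l = S (M^ (l ℕ.∸ 1) (e q))
    summand : ℕ → Carrier
    summand l = S (M^ (ℕ.suc k ℕ.∸ l) u) * E l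

  T : ℕ → ℕ → Carrier
  T q j = S (M^ j (e q))

  M^-[] : ∀ n → M^ n [] ≡ []
  M^-[] ℕ.zero    = ≡.refl
  M^-[] (ℕ.suc n) = ≡.cong M (M^-[] n)

  M^-singleton : ∀ n x → M^ n (x ∷ []) ≡ x ∷ []
  M^-singleton ℕ.zero    x = ≡.refl
  M^-singleton (ℕ.suc n) x = ≡.cong M (M^-singleton n x)

  S-M^-one : ∀ n → S (M^ n (1# ∷ [])) ≈ 1#
  S-M^-one n = trans (reflexive (≡.cong S (M^-singleton n 1#))) (+-identityʳ 1#)

  -- sumFormula applied to e_{q+1} = (1) ++ e_q.
  T-rec : ∀ q j → T (ℕ.suc q) j ≈ 1# + T q j + Σ₁ j (λ l → T q (l ℕ.∸ 1))
  T-rec q j = trans (sumFormula j (1# ∷ []) (e q))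
    (+-cong (+-congʳ (S-M^-one j)) (Σ₁-cong j (λ l _ → trans (*-congʳ (S-M^-one (j ℕ.∸ ℕ.suc l))) (*-identityˡ _))))

  ι-+ : ∀ a b → ι (a ℕ.+ b) ≈ ι a + ι b
  ι-+ ℕ.zero    b = sym (+-identityˡ (ι b))
  ι-+ (ℕ.suc a) b = trans (+-congˡ (ι-+ a b)) (sym (+-assoc 1# (ι a) (ι b)))

  ι-Σ : ∀ j f → ι (ΣN j f) ≈ Σ₁ j (λ l → ι (f l))
  ι-Σ ℕ.zero    f = refl
  ι-Σ (ℕ.suc j) f = trans (ι-+ (ΣN j f) (f (ℕ.suc j))) (+-congʳ (ι-Σ j f))

  T≈binomial : ∀ q j → T q j ≈ ι ((q ℕ.+ j) C ℕ.suc j)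
  T≈binomial ℕ.zero j = begin
    S (M^ j [])             ≡⟨ ≡.cong S (M^-[] j) ⟩
    0#                      ≡⟨ ≡.cong ι (k>n⇒nCk≡0 {j} {ℕ.suc j} ℕₚ.≤-refl) ⟨
    ι (j C ℕ.suc j)         ∎
  T≈binomial (ℕ.suc q) j = begin
    T (ℕ.suc q) j
      ≈⟨ T-rec q j ⟩
    1# + T q j + Σ₁ j (λ l → T q (l ℕ.∸ 1))
      ≈⟨ +-cong (+-congˡ (T≈binomial q j)) (Σ₁-cong j (λ l _ → T≈binomial q l)) ⟩
    1# + ι ((q ℕ.+ j) C ℕ.suc j) + Σ₁ j (λ l → ι (binomialTerm q l))
      ≈⟨ +-congˡ (ι-Σ j (binomialTerm q)) ⟨
    ι (1 ℕ.+ (q ℕ.+ j) C ℕ.suc j) + ι (ΣN j (binomialTerm q))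
      ≈⟨ ι-+ (1 ℕ.+ (q ℕ.+ j) C ℕ.suc j) (ΣN j (binomialTerm q)) ⟨
    ι (1 ℕ.+ (q ℕ.+ j) C ℕ.suc j ℕ.+ ΣN j (binomialTerm q))
      ≡⟨ ≡.cong ι (hockeyStick q j) ⟨
    ι ((ℕ.suc q ℕ.+ j) C ℕ.suc j) ∎

  T≈binomial′ : ∀ q l → T q l ≈ ι ((q ℕ.+ ℕ.suc l ℕ.∸ 1) C ℕ.suc l)
  T≈binomial′ q l = trans (T≈binomial q l) (reflexive (≡.cong (λ n → ι (n C ℕ.suc l)) (≡.sym (≡.cong (ℕ._∸ 1) (ℕₚ.+-suc q l)))))

corollary1 : ∀ {c ℓ} (R : CommutativeRing c ℓ) → let open CommutativeRing R in let open Seq R in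
    ∀ {p q : ℕ} (u : Vec Carrier p) (v : Vec Carrier q) (k : ℕ) → 1 ℕ.≤ k →
    (S (M^ k (u ++ v)) ≈ S (M^ k u) + S (M^ k v) + Σ₁ k (λ l → S (M^ (k ℕ.∸ l) u) * S (M^ (l ℕ.∸ 1) (e q))))
    × (S (M^ k (u ++ v)) ≈ S (M^ k u) + S (M^ k v) + Σ₁ k (λ l → S (M^ (k ℕ.∸ l) u) * ι ((q ℕ.+ l ℕ.∸ 1) C l)))
corollary1 R {q = q} u v k _ =
  sumFormula k u v ,
  trans (sumFormula k u v) (+-congˡ (Σ₁-cong k (λ l _ → *-congˡ (T≈binomial′ q l))))
  where
  open CommutativeRing R
  open Development R
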